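{- Let $X$ be a finite set with $n$ elements and let $\mathcal{P}_1,\dots,\mathcal{P}_n$ be a cluster tree for $X$. Then this cluster tree has a cluster representation $f:X\to\{0,1,\dots,\lfloor(1+\sqrt2)^n/4\rfloor\}$, where the target set carries the Euclidean distance $e(s,t)=|s-t|$.
   Context: A cluster tree for a finite set $X$ with $|X|=n$ is a chain of partitions $\mathcal{P}_1,\dots,\mathcal{P}_n$ of $X$, where $\mathcal{P}_1=\{\{x\}:x\in X\}$, $\mathcal{P}_n=\{X\}$, and each $\mathcal{P}_{k+1}$ ($k<n$) arises from $\mathcal{P}_k$ by replacing two distinct blocks $A,B\in\mathcal{P}_k$ by their union $A\cup B$. A (hierarchical) clustering method assigns to a finite set with a distance function a cluster tree. It satisfies property $(\star)$ if, applied to $(X,d)$, it produces $\mathcal{P}_1,\dots,\mathcal{P}_n$ with the following property: whenever $k<n$, $A,B\in\mathcal{P}_k$, $A\neq B$, and for all $a\in A$, $b\in B$ and $x,y\in X$ either $x,y\in A\cup B$, or $x,y\in C$ for some $C\in\mathcal{P}_k$, or $d(a,b)<d(x,y)$, then $A\cup B\in\mathcal{P}_{k+1}$. A map $f:X\to Y$ into a metric space $(Y,e)$ is a cluster representation of a given cluster tree if every clustering method satisfying $(\star)$, applied to $(X,d')$ with $d'(x,y):=e(f(x),f(y))$, reproduces exactly this cluster tree. -}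

module Defs where

open import Data.Nat using (ℕ; zero; suc; _+_; _*_; _∸_; _^_; _≤_; _<_; ∣_-_∣)
open import Data.Fin using (Fin)
open import Data.Fin.Subset using (Subset; _∈_; _∪_; ⁅_⁆; ⊤; Nonempty)
open import Data.Bool using (Bool; true; false)
open import Data.Product using (Σ; ∃; ∃-syntax; _×_; _,_)
open import Data.Sum using (_⊎_)
open import Relation.Nullary using (¬_)
open import Relation.Binary.PropositionalEquality using (_≡_)
open import Function.Bundles using (_⇔_)

Family : ℕ → Set
Family n = Subset n → Bool

Block : ∀ {n} → Family n → Subset n → Set
Block P A = P A ≡ true

record IsPartition {n : ℕ} (P : Family n) : Set where
  field
    nonempty : ∀ A → Block P A → Nonempty A
    cover    : ∀ x → ∃[ A ] (Block P A × x ∈ A)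
    disjoint : ∀ A B x → Block P A → Block P B → x ∈ A → x ∈ B → A ≡ B

IsSingletons : ∀ {n} → Family n → Set
IsSingletons {n} P = ∀ A → Block P A ⇔ (∃[ x ] A ≡ ⁅ x ⁆)

IsTrivial : ∀ {n} → Family n → Set
IsTrivial {n} P = ∀ A → Block P A ⇔ (A ≡ ⊤)

IsMerge : ∀ {n} → Family n → Family n → Set
IsMerge {n} P Q =
  Σ (Subset n) λ A → Σ (Subset n) λ B →
    Block P A × Block P B × ¬ (A ≡ B) ×
    (∀ C → Block Q C ⇔ (C ≡ A ∪ B ⊎ (Block P C × ¬ (C ≡ A) × ¬ (C ≡ B))))

-- Cluster trees: P 1, …, P n (indices outside 1..n are irrelevant).

record ClusterTree (n : ℕ) : Set where
  field
    P         : ℕ → Family n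
    partition : ∀ k → 1 ≤ k → k ≤ n → IsPartition (P k)
    first     : 1 ≤ n → IsSingletons (P 1)
    last      : 1 ≤ n → IsTrivial (P n)
    step      : ∀ k → 1 ≤ k → k < n → IsMerge (P k) (P (suc k))

SameTree : ∀ {n} → ClusterTree n → ClusterTree n → Set
SameTree {n} T T' = ∀ k → 1 ≤ k → k ≤ n → ∀ A → ClusterTree.P T k A ≡ ClusterTree.P T' k A

Dist : ℕ → Set
Dist n = Fin n → Fin n → ℕ

Star : ∀ {n} → Dist n → ClusterTree n → Set
Star {n} d T =
  ∀ k → 1 ≤ k → k < n → ∀ A B → Block (P k) A → Block (P k) B → ¬ (A ≡ B) →
    (∀ a b x y → a ∈ A → b ∈ B →
        ((x ∈ A ∪ B × y ∈ A ∪ B)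
         ⊎ (∃[ C ] (Block (P k) C × x ∈ C × y ∈ C))
         ⊎ d a b < d x y)) →
    Block (P (suc k)) (A ∪ B)
  where open ClusterTree T

Method : Set
Method = (m : ℕ) → Dist m → ClusterTree m

SatisfiesStar : Method → Set
SatisfiesStar M = ∀ m (d : Dist m) → Star d (M m d)

IsClusterRep : ∀ {n} → ClusterTree n → (Fin n → ℕ) → Set
IsClusterRep {n} T f =
  ∀ (M : Method) → SatisfiesStar M → SameTree (M n (λ x y → ∣ f x - f y ∣)) T

-- (1 + √2)^n = α n + β n · √2 with α n, β n ∈ ℕ.

α β : ℕ → ℕ
α zero    = 1
α (suc n) = α n + 2 * β n
β zero    = 0
β (suc n) = α n + β n

-- s ≤ ⌊(1+√2)^n / 4⌋  ⇔  4 s ≤ α n + β n √2  ⇔  (4 s ∸ α n)² ≤ 2 (β n)²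
InRange : ℕ → ℕ → Set
InRange n s = (4 * s ∸ α n) ^ 2 ≤ 2 * β n ^ 2

{-# OPTIONS --safe #-}

-- All points start at 0.  When blocks A and B of 𝒫ₖ are merged, B is translated
-- rigidly to the right of A, leaving a gap larger than the current spread sₖ of the
-- layout.  Afterwards the blocks of 𝒫ₖ are only ever translated rigidly, so in the
-- final layout two points are within distance sₖ iff they are together in 𝒫ₖ; hence a
-- method with (⋆) has to merge exactly A and B at step k, and by induction it
-- reproduces the tree.  The points above sₖ₋₁ all lie in one block of 𝒫ₖ, so at most
-- one of A, B reaches above sₖ₋₁ and the layout stays within sₖ₊₁ = 2 sₖ + sₖ₋₁ + 1.
-- This recurrence gives 2 sₖ + 1 = αₖ, where (1+√2)ᵏ = αₖ + βₖ√2 and αₖ² − 2βₖ² = ±1,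
-- whence 4 sₙ ≤ (1+√2)ⁿ.

module Submission where

open import Defs
open import Data.Nat
  using (ℕ; zero; suc; _+_; _*_; _∸_; _^_; _⊔_; ∣_-_∣; _≤_; _<_; _≤′_; ≤′-refl; ≤′-step; z≤n; s≤s; z<s; _≤?_; _<?_)
open import Data.Nat.Properties
open import Data.Nat.Tactic.RingSolver using (solve-∀)
open import Data.Fin using (Fin; zero; suc)
open import Data.Fin.Subset using (Subset; _∈_; _∉_; _∪_; _⊆_; ⊤; inside; outside)
open import Data.Fin.Subset.Properties using (_∈?_; _⊆?_; ∈⊤; p⊆p∪q; q⊆p∪q; x∈p∪q⁻)
open import Data.Vec using ([]; _∷_; here; there)
open import Data.Bool using (true)
open import Data.Bool.Properties using (⇔→≡)
open import Data.Product using (Σ; ∃-syntax; _×_; _,_; proj₁; proj₂)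
open import Data.Sum using (_⊎_; inj₁; inj₂; [_,_])
import Data.Sum as Sum
import Data.Product as Product
open import Function using (_∘_; id)
open import Function.Bundles using (_⇔_; mk⇔; Equivalence)
import Function.Properties.Equivalence as ⇔
open import Relation.Nullary using (¬_; Dec; yes; no; contradiction)
open import Relation.Nullary.Decidable using (decidable-stable)
open import Relation.Binary.PropositionalEquality
  using (_≡_; refl; sym; trans; cong; cong₂; subst; _≗_; module ≡-Reasoning)

private
  variable
    n lo hi w : ℕ
    P Q Q′ : Family n
    A B C A′ B′ : Subset n
    x y : Fin n
    f : Fin n → ℕ

m≤2m+n+1 : ∀ m n → m ≤ 2 * m + n + 1
m≤2m+n+1 m n = ≤-trans (m≤m+n m (m + 0)) (≤-trans (m≤m+n _ n) (m≤m+n _ 1))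

spread : ℕ → ℕ
spread zero = 0
spread (suc zero) = 0
spread (suc (suc j)) = 2 * spread (suc j) + spread j + 1

spread-suc : ∀ j → spread j ≤ spread (suc j)
spread-suc zero = z≤n
spread-suc (suc j) = m≤2m+n+1 (spread (suc j)) (spread j)

spread-mono : ∀ {i k} → i ≤′ k → spread i ≤ spread k
spread-mono ≤′-refl = ≤-refl
spread-mono (≤′-step {k} i≤′k) = ≤-trans (spread-mono i≤′k) (spread-suc k)

α-recurrence : ∀ j → α (suc (suc j)) ≡ 2 * α (suc j) + α j
α-recurrence j = lemma (α j) (β j)
  where
  lemma : ∀ a b → a + 2 * b + 2 * (a + b) ≡ 2 * (a + 2 * b) + a
  lemma = solve-∀

2*spread+1≡α : ∀ j → 2 * spread j + 1 ≡ α j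
2*spread+1≡α zero = refl
2*spread+1≡α (suc zero) = refl
2*spread+1≡α (suc (suc j)) = begin
  2 * (2 * s₁ + s₀ + 1) + 1        ≡⟨ regroup s₁ s₀ ⟩
  2 * (2 * s₁ + 1) + (2 * s₀ + 1)  ≡⟨ cong₂ (λ u v → 2 * u + v) (2*spread+1≡α (suc j))
                                                                  (2*spread+1≡α j) ⟩
  2 * α (suc j) + α j              ≡⟨ α-recurrence j ⟨
  α (suc (suc j))                  ∎
  where
  open ≡-Reasoning
  s₀ = spread j
  s₁ = spread (suc j)
  regroup : ∀ x y → 2 * (2 * x + y + 1) + 1 ≡ 2 * (2 * x + 1) + (2 * y + 1)
  regroup = solve-∀

squares-step : ∀ a b → a * a + (a + 2 * b) * (a + 2 * b) ≡ 2 * (b * b) + 2 * ((a + b) * (a + b))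
squares-step = solve-∀

α-Pell : ∀ j → α j * α j ≡ 1 + 2 * (β j * β j) ⊎ 1 + α j * α j ≡ 2 * (β j * β j)
α-Pell zero = inj₁ refl
α-Pell (suc j) with α-Pell j
... | inj₁ e = inj₂ (+-cancelˡ-≡ (2 * (b * b)) _ _ (begin
  2 * (b * b) + (1 + a′ * a′)  ≡⟨ +-suc _ _ ⟩
  1 + 2 * (b * b) + a′ * a′    ≡⟨ cong (_+ a′ * a′) e ⟨
  a * a + a′ * a′              ≡⟨ squares-step a b ⟩
  2 * (b * b) + 2 * (b′ * b′)  ∎))
  where
  open ≡-Reasoning
  a = α j ; b = β j ; a′ = α (suc j) ; b′ = β (suc j)
... | inj₂ e = inj₁ (+-cancelˡ-≡ (2 * (b * b)) _ _ (begin
  2 * (b * b) + a′ * a′        ≡⟨ cong (_+ a′ * a′) e ⟨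
  1 + a * a + a′ * a′          ≡⟨ cong suc (squares-step a b) ⟩
  1 + (2 * (b * b) + 2 * (b′ * b′)) ≡⟨ +-suc _ _ ⟨
  2 * (b * b) + (1 + 2 * (b′ * b′)) ∎))
  where
  open ≡-Reasoning
  a = α j ; b = β j ; a′ = α (suc j) ; b′ = β (suc j)

m^2≡m*m : ∀ m → m ^ 2 ≡ m * m
m^2≡m*m m = cong (m *_) (*-identityʳ m)

α²≤1+2β² : ∀ j → α j ^ 2 ≤ 1 + 2 * β j ^ 2
α²≤1+2β² j rewrite m^2≡m*m (α j) | m^2≡m*m (β j) with α-Pell j
... | inj₁ e = ≤-reflexive e
... | inj₂ e = ≤-trans (n≤1+n _) (≤-trans (≤-reflexive e) (n≤1+n _))

spread⇒InRange : ∀ {j s} → s ≤ spread j → InRange j s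
spread⇒InRange {j} {s} s≤spread with α j ≤? 4 * s
... | no α≰4s rewrite m≤n⇒m∸n≡0 (<⇒≤ (≰⇒> α≰4s)) = z≤n
... | yes α≤4s = ≤-pred (begin-strict
  t ^ 2            <⟨ ^-monoˡ-< 2 (m<m+n t z<s) ⟩
  (t + 2) ^ 2      ≤⟨ ^-monoˡ-≤ 2 t+2≤α ⟩
  α j ^ 2          ≤⟨ α²≤1+2β² j ⟩
  1 + 2 * β j ^ 2  ∎)
  where
  open ≤-Reasoning
  t = 4 * s ∸ α j
  double : ∀ x → 4 * x + 2 ≡ (2 * x + 1) + (2 * x + 1)
  double = solve-∀
  t+2≤α : t + 2 ≤ α j
  t+2≤α = +-cancelˡ-≤ (α j) _ _ (begin
    α j + (t + 2)        ≡⟨ +-assoc (α j) t 2 ⟨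
    α j + t + 2          ≡⟨ cong (_+ 2) (m+[n∸m]≡n α≤4s) ⟩
    4 * s + 2            ≤⟨ +-monoˡ-≤ 2 (*-monoʳ-≤ 4 s≤spread) ⟩
    4 * spread j + 2     ≡⟨ double (spread j) ⟩
    (2 * spread j + 1) + (2 * spread j + 1) ≡⟨ cong₂ _+_ (2*spread+1≡α j) (2*spread+1≡α j) ⟩
    α j + α j            ∎)

Together : Family n → Fin n → Fin n → Set
Together P x y = ∃[ C ] (Block P C × x ∈ C × y ∈ C)

-- IsMerge P Q unfolds to Σ A Σ B (MergeOf P Q A B).
MergeOf : Family n → Family n → Subset n → Subset n → Set
MergeOf P Q A B = Block P A × Block P B × ¬ (A ≡ B) ×
  (∀ C → Block Q C ⇔ (C ≡ A ∪ B ⊎ (Block P C × ¬ (C ≡ A) × ¬ (C ≡ B))))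

Fused : Family n → Subset n → Subset n → Set
Fused P U C = C ≡ U ⊎ (Block P C × ¬ (C ⊆ U))

blocks⇔⇒≗ : (∀ C → Block P C ⇔ Block Q C) → P ≗ Q
blocks⇔⇒≗ P⇔Q C = ⇔→≡ (P⇔Q C)

block-resp : P ≗ Q → Block P C → Block Q C
block-resp {C = C} P≗Q = subst (_≡ true) (P≗Q C)

together-sym : Together P x y → Together P y x
together-sym (C , C∈P , x∈C , y∈C) = C , C∈P , y∈C , x∈C

together-resp : P ≗ Q → Together P x y → Together Q x y
together-resp P≗Q (C , C∈P , x∈C , y∈C) = C , block-resp P≗Q C∈P , x∈C , y∈C

merge-resp : P ≗ Q → MergeOf P Q′ A B → MergeOf Q Q′ A B
merge-resp P≗Q (A∈P , B∈P , A≢B , Q′⇔) =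
  block-resp P≗Q A∈P , block-resp P≗Q B∈P , A≢B ,
  λ C → mk⇔ (Sum.map₂ (Product.map₁ (block-resp P≗Q)) ∘ Equivalence.to (Q′⇔ C))
            (Equivalence.from (Q′⇔ C) ∘ Sum.map₂ (Product.map₁ (block-resp (sym ∘ P≗Q))))

singletons-unique : IsSingletons P → IsSingletons Q → P ≗ Q
singletons-unique P-singletons Q-singletons =
  blocks⇔⇒≗ λ C → ⇔.trans (P-singletons C) (⇔.sym (Q-singletons C))

module _ (π : IsPartition P) where
  open IsPartition π

  together⇒∈ : Block P C → Together P x y → x ∈ C → y ∈ C
  together⇒∈ C∈P (D , D∈P , x∈D , y∈D) x∈C = subst (_ ∈_) (disjoint D _ _ D∈P C∈P x∈D x∈C) y∈D

  together? : ∀ x y → Dec (Together P x y)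
  together? x y with cover x
  ... | C , C∈P , x∈C with y ∈? C
  ...   | yes y∈C = yes (C , C∈P , x∈C , y∈C)
  ...   | no y∉C = no λ x~y → y∉C (together⇒∈ C∈P x~y x∈C)

  block-⊆-∪ : Block P A → Block P B → Block P C → C ⊆ A ∪ B → C ≡ A ⊎ C ≡ B
  block-⊆-∪ {A} {B} {C} A∈P B∈P C∈P C⊆A∪B with nonempty C C∈P
  ... | c , c∈C with x∈p∪q⁻ A B (C⊆A∪B c∈C)
  ...   | inj₁ c∈A = inj₁ (disjoint C A c C∈P A∈P c∈C c∈A)
  ...   | inj₂ c∈B = inj₂ (disjoint C B c C∈P B∈P c∈C c∈B)

  ∪-not-block : Block P A → Block P B → ¬ (A ≡ B) → ¬ Block P (A ∪ B)
  ∪-not-block {A} {B} A∈P B∈P A≢B A∪B∈P with nonempty A A∈P | nonempty B B∈P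
  ... | a , a∈A | b , b∈B = A≢B (trans
    (disjoint A (A ∪ B) a A∈P A∪B∈P a∈A (p⊆p∪q B a∈A))
    (sym (disjoint B (A ∪ B) b B∈P A∪B∈P b∈B (q⊆p∪q A B b∈B))))

  merged-disjoint : MergeOf P Q A B → x ∈ A → x ∉ B
  merged-disjoint (A∈P , B∈P , A≢B , _) x∈A x∈B = A≢B (disjoint _ _ _ A∈P B∈P x∈A x∈B)

merged-block : MergeOf P Q A B → Block Q (A ∪ B)
merged-block (_ , _ , _ , Q⇔) = Equivalence.from (Q⇔ _) (inj₁ refl)

unmerged-block : MergeOf P Q A B → Block P C → ¬ (C ⊆ A ∪ B) → Block Q C
unmerged-block {A = A} {B = B} {C = C} (_ , _ , _ , Q⇔) C∈P C⊈A∪B =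
  Equivalence.from (Q⇔ C)
    (inj₂ (C∈P , (λ { refl → C⊈A∪B (p⊆p∪q B) }) , λ { refl → C⊈A∪B (q⊆p∪q A B) }))

together-merge : MergeOf P Q A B → Together P x y → Together Q x y
together-merge {A = A} {B = B} merge (C , C∈P , x∈C , y∈C) with C ⊆? A ∪ B
... | yes C⊆A∪B = A ∪ B , merged-block merge , C⊆A∪B x∈C , C⊆A∪B y∈C
... | no C⊈A∪B = C , unmerged-block merge C∈P C⊈A∪B , x∈C , y∈C

together-merge⁻ : MergeOf P Q A B → Together Q x y → (x ∈ A ∪ B × y ∈ A ∪ B) ⊎ Together P x y
together-merge⁻ (_ , _ , _ , Q⇔) (C , C∈Q , x∈C , y∈C) with Equivalence.to (Q⇔ C) C∈Q
... | inj₁ refl = inj₁ (x∈C , y∈C)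
... | inj₂ (C∈P , _) = inj₂ (C , C∈P , x∈C , y∈C)

module _ (π : IsPartition P) where

  merge-block⇔ : MergeOf P Q A B → ∀ C → Block Q C ⇔ Fused P (A ∪ B) C
  merge-block⇔ {Q = Q} merge@(A∈P , B∈P , _ , Q⇔) C = mk⇔ to from
    where
    to : Block Q C → Fused P _ C
    to C∈Q with Equivalence.to (Q⇔ C) C∈Q
    ... | inj₁ C≡A∪B = inj₁ C≡A∪B
    ... | inj₂ (C∈P , C≢A , C≢B) = inj₂ (C∈P , [ C≢A , C≢B ] ∘ block-⊆-∪ π A∈P B∈P C∈P)
    from : Fused P _ C → Block Q C
    from (inj₁ refl) = merged-block merge
    from (inj₂ (C∈P , C⊈A∪B)) = unmerged-block merge C∈P C⊈A∪B

  merged-union-unique : MergeOf P Q A B → MergeOf P Q′ A′ B′ → Block Q′ (A ∪ B) → A ∪ B ≡ A′ ∪ B′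
  merged-union-unique (A∈P , B∈P , A≢B , _) merge′ A∪B∈Q′
    with Equivalence.to (merge-block⇔ merge′ _) A∪B∈Q′
  ... | inj₁ A∪B≡A′∪B′ = A∪B≡A′∪B′
  ... | inj₂ (A∪B∈P , _) = contradiction A∪B∈P (∪-not-block π A∈P B∈P A≢B)

  merge-determined : MergeOf P Q A B → MergeOf P Q′ A′ B′ → Block Q′ (A ∪ B) → Q′ ≗ Q
  merge-determined {Q = Q} merge merge′ A∪B∈Q′ = blocks⇔⇒≗ λ C →
    ⇔.trans (merge-block⇔ merge′ C)
      (subst (λ U → Fused P U C ⇔ Block Q C) (merged-union-unique merge merge′ A∪B∈Q′)
        (⇔.sym (merge-block⇔ merge C)))

dist : (Fin n → ℕ) → Fin n → Fin n → ℕ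
dist f x y = ∣ f x - f y ∣

maxOn : (Fin n → ℕ) → Subset n → ℕ
maxOn f [] = 0
maxOn f (inside ∷ p) = f zero ⊔ maxOn (f ∘ suc) p
maxOn f (outside ∷ p) = maxOn (f ∘ suc) p

≤-maxOn : ∀ {p : Subset n} → x ∈ p → f x ≤ maxOn f p
≤-maxOn {f = f} here = m≤m⊔n (f zero) _
≤-maxOn {p = inside ∷ p} (there x∈p) = ≤-trans (≤-maxOn x∈p) (m≤n⊔m _ _)
≤-maxOn {p = outside ∷ p} (there x∈p) = ≤-maxOn x∈p

maxOn-lub : ∀ {p : Subset n} {c} → (∀ {x} → x ∈ p → f x ≤ c) → maxOn f p ≤ c
maxOn-lub {p = []} _ = z≤n
maxOn-lub {p = inside ∷ p} f≤c = ⊔-lub (f≤c here) (maxOn-lub (f≤c ∘ there))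
maxOn-lub {p = outside ∷ p} f≤c = maxOn-lub (f≤c ∘ there)

shiftPast : (Fin n → ℕ) → Subset n → Subset n → ℕ → Fin n → ℕ
shiftPast f A B w x with x ∈? B
... | yes _ = maxOn f A + suc w + f x
... | no _ = f x

shiftPast-∈ : x ∈ B → shiftPast f A B w x ≡ maxOn f A + suc w + f x
shiftPast-∈ {x = x} {B = B} x∈B with x ∈? B
... | yes _ = refl
... | no x∉B = contradiction x∈B x∉B

shiftPast-∉ : x ∉ B → shiftPast f A B w x ≡ f x
shiftPast-∉ {x = x} {B = B} x∉B with x ∈? B
... | yes x∈B = contradiction x∈B x∉B
... | no _ = refl

m≤n⇒o<∣m-n+suc[o]+p∣ : ∀ {m n} o p → m ≤ n → o < ∣ m - n + suc o + p ∣
m≤n⇒o<∣m-n+suc[o]+p∣ {m} {n} o p m≤n = begin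
  suc o                   ≤⟨ m+n≤o⇒m≤o∸n (suc o) m+1+o≤n+1+o+p ⟩
  n + suc o + p ∸ m       ≤⟨ m∸n≤∣m-n∣ _ m ⟩
  ∣ n + suc o + p - m ∣   ≡⟨ ∣-∣-comm _ m ⟩
  ∣ m - n + suc o + p ∣   ∎
  where
  open ≤-Reasoning
  m+1+o≤n+1+o+p : suc o + m ≤ n + suc o + p
  m+1+o≤n+1+o+p = begin
    suc o + m      ≡⟨ +-comm (suc o) m ⟩
    m + suc o      ≤⟨ +-monoˡ-≤ (suc o) m≤n ⟩
    n + suc o      ≤⟨ m≤m+n _ p ⟩
    n + suc o + p  ∎

shiftPast-separates : x ∈ A → x ∉ B → y ∈ B → w < dist (shiftPast f A B w) x y
shiftPast-separates {x = x} {A = A} {B = B} {y = y} {w = w} {f = f} x∈A x∉B y∈B = begin-strict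
  w                                  <⟨ m≤n⇒o<∣m-n+suc[o]+p∣ w (f y) (≤-maxOn {f = f} x∈A) ⟩
  ∣ f x - maxOn f A + suc w + f y ∣  ≡⟨ cong₂ ∣_-_∣ (shiftPast-∉ {f = f} {A = A} {w = w} x∉B)
                                                   (shiftPast-∈ {f = f} {A = A} {w = w} y∈B) ⟨
  dist (shiftPast f A B w) x y       ∎
  where open ≤-Reasoning

module _ (π : IsPartition P) where

  shiftPast-dist : Block P B → Together P x y → dist (shiftPast f A B w) x y ≡ dist f x y
  shiftPast-dist {B = B} {x = x} {y = y} {f = f} {A = A} {w = w} B∈P x~y = by-cases (x ∈? B)
    where
    by-cases : Dec (x ∈ B) → dist (shiftPast f A B w) x y ≡ dist f x y
    by-cases (yes x∈B) = begin
      ∣ shiftPast f A B w x - shiftPast f A B w y ∣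
        ≡⟨ cong₂ ∣_-_∣ (shiftPast-∈ x∈B) (shiftPast-∈ (together⇒∈ π B∈P x~y x∈B)) ⟩
      ∣ maxOn f A + suc w + f x - maxOn f A + suc w + f y ∣
        ≡⟨ ∣m+n-m+o∣≡∣n-o∣ (maxOn f A + suc w) (f x) (f y) ⟩
      ∣ f x - f y ∣ ∎
      where open ≡-Reasoning
    by-cases (no x∉B) =
      cong₂ ∣_-_∣ (shiftPast-∉ x∉B) (shiftPast-∉ (x∉B ∘ together⇒∈ π B∈P (together-sym x~y)))

  shiftPast-separates-merged : MergeOf P Q A B → ¬ Together P x y → Together Q x y →
                               w < dist (shiftPast f A B w) x y
  shiftPast-separates-merged {A = A} {B = B} {x = x} {y = y} {w = w} {f = f}
                             merge@(A∈P , B∈P , _) x≁y x~y with together-merge⁻ merge x~y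
  ... | inj₂ x~y = contradiction x~y x≁y
  ... | inj₁ (x∈A∪B , y∈A∪B) with x∈p∪q⁻ A B x∈A∪B | x∈p∪q⁻ A B y∈A∪B
  ...   | inj₁ x∈A | inj₁ y∈A = contradiction (A , A∈P , x∈A , y∈A) x≁y
  ...   | inj₂ x∈B | inj₂ y∈B = contradiction (B , B∈P , x∈B , y∈B) x≁y
  ...   | inj₁ x∈A | inj₂ y∈B = shiftPast-separates {f = f} x∈A (merged-disjoint π merge x∈A) y∈B
  ...   | inj₂ x∈B | inj₁ y∈A = subst (w <_) (∣-∣-comm (shiftPast f A B w y) (shiftPast f A B w x))
                                  (shiftPast-separates {f = f} y∈A (merged-disjoint π merge y∈A) x∈B)

record Fits (P : Family n) (lo hi : ℕ) (f : Fin n → ℕ) : Set where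
  field
    bounded : ∀ x → f x ≤ hi
    high-together : lo < f x → lo < f y → Together P x y

const-fits : Fits P lo hi (λ _ → 0)
const-fits = record { bounded = λ _ → z≤n ; high-together = λ () }

module _ (π : IsPartition P) (merge : MergeOf P Q A B) (fits : Fits P lo hi f) where
  open Fits fits

  maxOn+≤ : x ∈ B → maxOn f A + f x ≤ hi + lo
  maxOn+≤ {x} x∈B with f x ≤? lo
  ... | yes fx≤lo = +-mono-≤ (maxOn-lub {p = A} λ {a} _ → bounded a) fx≤lo
  ... | no fx≰lo = ≤-trans (+-mono-≤ (maxOn-lub {p = A} A-low) (bounded x)) (≤-reflexive (+-comm lo hi))
    where
    A-low : ∀ {a} → a ∈ A → f a ≤ lo
    A-low {a} a∈A with f a ≤? lo
    ... | yes fa≤lo = fa≤lo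
    ... | no fa≰lo = contradiction x∈B (merged-disjoint π merge
          (together⇒∈ π (proj₁ merge) (high-together (≰⇒> fa≰lo) (≰⇒> fx≰lo)) a∈A))

  shiftPast-fits : Fits Q hi (2 * hi + lo + 1) (shiftPast f A B hi)
  shiftPast-fits = record { bounded = λ x → by-cases x (x ∈? B) ; high-together = high-together′ }
    where
    by-cases : ∀ x → Dec (x ∈ B) → shiftPast f A B hi x ≤ 2 * hi + lo + 1
    by-cases x (yes x∈B) = begin
      shiftPast f A B hi x        ≡⟨ shiftPast-∈ x∈B ⟩
      maxOn f A + suc hi + f x    ≡⟨ regroup (maxOn f A) hi (f x) ⟩
      maxOn f A + f x + suc hi    ≤⟨ +-monoˡ-≤ (suc hi) (maxOn+≤ x∈B) ⟩
      hi + lo + suc hi            ≡⟨ collect hi lo ⟩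
      2 * hi + lo + 1             ∎
      where
      open ≤-Reasoning
      regroup : ∀ m h v → m + suc h + v ≡ m + v + suc h
      regroup = solve-∀
      collect : ∀ h l → h + l + suc h ≡ 2 * h + l + 1
      collect = solve-∀
    by-cases x (no x∉B) = ≤-trans (≤-reflexive (shiftPast-∉ x∉B)) (≤-trans (bounded x) (m≤2m+n+1 hi lo))

    high⇒∈ : hi < shiftPast f A B hi x → x ∈ B
    high⇒∈ {x} hi<fx = decidable-stable (x ∈? B) λ x∉B →
      <⇒≱ (subst (hi <_) (shiftPast-∉ x∉B) hi<fx) (bounded x)

    high-together′ : hi < shiftPast f A B hi x → hi < shiftPast f A B hi y → Together Q x y
    high-together′ hi<fx hi<fy =
      A ∪ B , merged-block merge , q⊆p∪q A B (high⇒∈ hi<fx) , q⊆p∪q A B (high⇒∈ hi<fy)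

module Layout {m : ℕ} (T : ClusterTree (suc m)) where
  open ClusterTree T renaming (P to 𝒫)

  partition-at : ∀ {i} → i ≤ m → IsPartition (𝒫 (suc i))
  partition-at i≤m = partition _ (s≤s z≤n) (s≤s i≤m)

  mergedPair : ℕ → Subset (suc m) × Subset (suc m)
  mergedPair i with i <? m
  ... | yes i<m = let A , B , _ = step (suc i) (s≤s z≤n) (s≤s i<m) in A , B
  ... | no _ = ⊤ , ⊤  -- junk: only i < m is ever used

  mergedˡ mergedʳ : ℕ → Subset (suc m)
  mergedˡ = proj₁ ∘ mergedPair
  mergedʳ = proj₂ ∘ mergedPair

  merge-at : ∀ {i} → i < m → MergeOf (𝒫 (suc i)) (𝒫 (suc (suc i))) (mergedˡ i) (mergedʳ i)
  merge-at {i} i<m with i <? m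
  ... | yes i<m′ = proj₂ (proj₂ (step (suc i) (s≤s z≤n) (s≤s i<m′)))
  ... | no i≮m = contradiction i<m i≮m

  -- layout i represents the partition 𝒫 (suc i)
  layout : ℕ → Fin (suc m) → ℕ
  layout zero = λ _ → 0
  layout (suc i) = shiftPast (layout i) (mergedˡ i) (mergedʳ i) (spread (suc i))

  layout-fits : ∀ {i} → i ≤ m → Fits (𝒫 (suc i)) (spread i) (spread (suc i)) (layout i)
  layout-fits {zero} _ = const-fits
  layout-fits {suc i} i<m = shiftPast-fits (partition-at (<⇒≤ i<m)) (merge-at i<m) (layout-fits (<⇒≤ i<m))

  together-mono : ∀ {i k} → i ≤′ k → k ≤ m → Together (𝒫 (suc i)) x y → Together (𝒫 (suc k)) x y
  together-mono ≤′-refl _ = id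
  together-mono (≤′-step i≤′k) k<m = together-merge (merge-at k<m) ∘ together-mono i≤′k (<⇒≤ k<m)

  dist-stable : ∀ {i k} → i ≤′ k → k ≤ m → Together (𝒫 (suc i)) x y →
                dist (layout k) x y ≡ dist (layout i) x y
  dist-stable ≤′-refl _ _ = refl
  dist-stable (≤′-step i≤′k) k<m x~y =
    trans (shiftPast-dist (partition-at (<⇒≤ k<m)) (proj₁ (proj₂ (merge-at k<m)))
                          (together-mono i≤′k (<⇒≤ k<m) x~y))
          (dist-stable i≤′k (<⇒≤ k<m) x~y)

  joined-later⇒spread<dist : ∀ {i k} → i ≤′ k → k ≤ m →
    ¬ Together (𝒫 (suc i)) x y → Together (𝒫 (suc k)) x y →
              spread (suc i) < dist (layout k) x y
  joined-later⇒spread<dist ≤′-refl _ x≁y x~y = contradiction x~y x≁y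
  joined-later⇒spread<dist {x = x} {y = y} {i = i} (≤′-step {k} i≤′k) k<m x≁y x~y
    with together? (partition-at (<⇒≤ k<m)) x y
  ... | yes x~ₖy = subst (spread (suc i) <_)
                     (sym (shiftPast-dist (partition-at (<⇒≤ k<m)) (proj₁ (proj₂ (merge-at k<m))) x~ₖy))
                     (joined-later⇒spread<dist i≤′k (<⇒≤ k<m) x≁y x~ₖy)
  ... | no x≁ₖy = ≤-<-trans (spread-mono (s≤′s i≤′k))
                    (shiftPast-separates-merged (partition-at (<⇒≤ k<m)) (merge-at k<m) x≁ₖy x~y)

  together⇒dist≤spread : ∀ {i} → i ≤ m → Together (𝒫 (suc i)) x y → dist (layout m) x y ≤ spread (suc i)
  together⇒dist≤spread {x = x} {y = y} {i = i} i≤m x~y = begin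
    dist (layout m) x y              ≡⟨ dist-stable (≤⇒≤′ i≤m) ≤-refl x~y ⟩
    ∣ layout i x - layout i y ∣      ≤⟨ ∣m-n∣≤m⊔n (layout i x) (layout i y) ⟩
    layout i x ⊔ layout i y          ≤⟨ ⊔-lub (bounded x) (bounded y) ⟩
    spread (suc i)                   ∎
    where
    open ≤-Reasoning
    open Fits (layout-fits i≤m)

  ¬together⇒spread<dist : ∀ {i} → i ≤ m → ¬ Together (𝒫 (suc i)) x y → spread (suc i) < dist (layout m) x y
  ¬together⇒spread<dist i≤m x≁y =
    joined-later⇒spread<dist (≤⇒≤′ i≤m) ≤-refl x≁y (⊤ , ⊤∈𝒫 , ∈⊤ , ∈⊤)
    where
    ⊤∈𝒫 : Block (𝒫 (suc m)) ⊤
    ⊤∈𝒫 = Equivalence.from (last (s≤s z≤n) ⊤) refl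

  star-premise : ∀ {i a b} → i < m → a ∈ mergedˡ i → b ∈ mergedʳ i → ∀ x y →
    (x ∈ mergedˡ i ∪ mergedʳ i × y ∈ mergedˡ i ∪ mergedʳ i)
    ⊎ Together (𝒫 (suc i)) x y
    ⊎ dist (layout m) a b < dist (layout m) x y
  star-premise {i} {a} {b} i<m a∈A b∈B x y with together? (partition-at {suc i} i<m) x y
  ... | yes x~y = Sum.map₂ inj₁ (together-merge⁻ (merge-at i<m) x~y)
  ... | no x≁y = inj₂ (inj₂ (≤-<-trans (together⇒dist≤spread i<m a~b) (¬together⇒spread<dist i<m x≁y)))
    where
    a~b : Together (𝒫 (suc (suc i))) a b
    a~b = _ , merged-block (merge-at i<m) , p⊆p∪q _ a∈A , q⊆p∪q _ _ b∈B

  layout-represents : IsClusterRep T (layout m)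
  layout-represents M M-star = λ { zero () _ ; (suc i) _ (s≤s i≤m) → agree i≤m }
    where
    T′ = M (suc m) (dist (layout m))
    open ClusterTree T′ using () renaming (P to 𝒫′; first to first′; step to step′)

    agree : ∀ {i} → i ≤ m → 𝒫′ (suc i) ≗ 𝒫 (suc i)
    agree {zero} _ = singletons-unique (first′ (s≤s z≤n)) (first (s≤s z≤n))
    agree {suc i} i<m = merge-determined (partition-at (<⇒≤ i<m)) merge merge′ merged∈𝒫′
      where
      𝒫′≗𝒫 = agree (<⇒≤ i<m)
      merge = merge-at i<m
      merge′ = merge-resp 𝒫′≗𝒫 (proj₂ (proj₂ (step′ (suc i) (s≤s z≤n) (s≤s i<m))))
      𝒫≗𝒫′ : 𝒫 (suc i) ≗ 𝒫′ (suc i)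
      𝒫≗𝒫′ = sym ∘ 𝒫′≗𝒫
      merged∈𝒫′ : Block (𝒫′ (suc (suc i))) (mergedˡ i ∪ mergedʳ i)
      merged∈𝒫′ = M-star (suc m) (dist (layout m)) (suc i) (s≤s z≤n) (s≤s i<m) _ _
        (block-resp 𝒫≗𝒫′ (proj₁ merge)) (block-resp 𝒫≗𝒫′ (proj₁ (proj₂ merge)))
        (proj₁ (proj₂ (proj₂ merge)))
        λ a b x y a∈A b∈B → Sum.map₂ (Sum.map₁ (together-resp 𝒫≗𝒫′)) (star-premise i<m a∈A b∈B x y)

proposition10 : (n : ℕ) → (T : ClusterTree n) →
    Σ (Fin n → ℕ) λ f → ((x : Fin n) → InRange n (f x)) × IsClusterRep T f
proposition10 zero T = (λ ()) , (λ ()) , λ { _ _ zero () ; _ _ (suc _) _ () }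
proposition10 (suc m) T =
  layout m , (λ x → spread⇒InRange {suc m} (Fits.bounded (layout-fits ≤-refl) x)) , layout-represents
  where open Layout T
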